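{- Let $\mu=(\mathrm{Val},(\mathcal P,\mathcal O),\varsigma)$ be a model with $\mathrm{Val}=\{0,0.5,1\}$ for the predicate symbols $\mathrm{input},\mathrm{echo}_1,\mathrm{echo}_2,\mathrm{output}$, whose semitopology is 3-twined, and suppose every axiom of $\mathrm{ThyCA}$ is valid in $\mu$. Then for every $v\in\{0,0.5,1\}$: (1) $\models\mathrm{input}(v)\to_s(v\doteq 0\vee v\doteq 1)$; (2) $\models\mathrm{echo}_1(v)\to_s(v\doteq 0\vee v\doteq 1)$; (3) $\models\mathrm{echo}_2(v)\to_s(v\doteq 0\vee v\doteq 1)$.
   Context: Truth values: $\mathbf 3=\{\mathbf f,\mathbf b,\mathbf t\}$ totally ordered by $\mathbf f<\mathbf b<\mathbf t$; $\wedge,\vee$ are min and max, $\bigwedge,\bigvee$ are infimum and supremum. Negation: $\neg\mathbf t=\mathbf f$, $\neg\mathbf b=\mathbf b$, $\neg\mathbf f=\mathbf t$. Modalities: $\mathsf T x=\mathbf t$ if $x=\mathbf t$, else $\mathbf f$; $\mathsf B x=\mathbf t$ if $x=\mathbf b$, else $\mathbf f$; $\mathsf{TF}x=\mathbf t$ if $x\in\{\mathbf t,\mathbf f\}$, else $\mathbf f$. Weak implication $x\to_w y:=\neg x\vee y$; strong implication $x\to_s y:=\neg x\vee\mathsf T y$. Exclusive-or: $x\oplus y=\mathbf b$ if $x=\mathbf b$ or $y=\mathbf b$; otherwise $\mathbf t$ if $x\neq y$ and $\mathbf f$ if $x=y$. A truth value is valid iff it lies in $\{\mathbf t,\mathbf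 b\}$. A semitopology $(\mathcal P,\mathcal O)$ is a set $\mathcal P$ with a family $\mathcal O$ of subsets containing $\mathcal P$ and closed under arbitrary (including empty) unions; $\mathcal O^{\neq\emptyset}$ is the set of nonempty members. It is 3-twined if any three members of $\mathcal O^{\neq\emptyset}$ have nonempty intersection. For $f:\mathcal P\to\mathbf 3$: $\mathsf{Everywhere} f=\bigwedge_{p}f(p)$, $\mathsf{Somewhere} f=\bigvee_p f(p)$, $\mathsf{Quorum} f=\bigvee_{O\in\mathcal O^{\neq\emptyset}}\bigwedge_{p\in O}f(p)$, $\mathsf{Contraquorum} f=\bigwedge_{O\in\mathcal O^{\neq\emptyset}}\bigvee_{p\in O}f(p)$. Logic: a model $\mu=(\mathrm{Val},(\mathcal P,\mathcal O),\varsigma)$ consists of a nonempty set $\mathrm{Val}$, a semitopology, and for each predicate symbol $R$ a function $\varsigma(R):\mathcal P\to\mathrm{Val}\to\mathbf 3$. Formulas are built from atoms $R(t)$, value equalities $v\doteq v'$ (denoting $\mathbf t$ if $v=v'$, else $\mathbf f$), connectives $\neg,\wedge,\vee,\to_w,\to_s,\oplus$, modalities $\mathsf T,\mathsf B,\mathsf{TF}$, operators $\mathsf{Everywhere},\mathsf{Somewhere},\mathsf{Quorum},\mathsf{Contraquorum}$ and quantifiers over $\mathrm{Val}$. Denotation $[\![\phi]\!]:\mathcal P\to\mathbf 3$: $[\![R(v)]\!](p)=\varsigma(R)(p)(v)$; connectives and modalities act pointwise in $p$; $[\![\mathsf{Quorum}\,\phi]\!](p)=\mathsf{Quorum}([\![\phi]\!])$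 for all $p$, likewise for the other three operators; $[\![\exists a.\phi]\!](p)=\bigvee_{v}[\![\phi[a:=v]]\!](p)$, $[\![\forall a.\phi]\!](p)=\bigwedge_{v}[\![\phi[a:=v]]\!](p)$; $[\![\exists_{01}a.\phi]\!](p)=\bigwedge_{v,v'}\big(([\![\phi[a:=v]]\!](p)\wedge[\![\phi[a:=v']]\!](p))\to_w (v\doteq v')\big)$. $p\models\phi$ iff $[\![\phi]\!](p)\in\{\mathbf t,\mathbf b\}$; $\models\phi$ iff $p\models\phi$ for all $p$. $\mathrm{correct}(R):=\forall a.\mathsf{TF}R(a)$, $\mathrm{incorrect}(R):=\forall a.\mathsf B R(a)$, $\mathrm{correct}(R_1,\dots,R_n):=\bigwedge_i\mathrm{correct}(R_i)$. Axioms with a free variable $a$ are universally quantified over $a$; an axiom is valid in $\mu$ if $\models$ it. $\mathrm{ThyCA}$ (with $\mathrm{Val}=\{0,0.5,1\}$) consists of: CaEcho1?: $\mathrm{echo}_1(a)\to_s\mathsf{Somewhere}\,\mathrm{input}(a)$; CaEcho2?: $\mathrm{echo}_2(a)\to_w\mathsf{Quorum}\,\mathrm{echo}_1(a)$; CaOutput?: $(\mathrm{output}(0)\to_w\mathsf{Quorum}\,\mathrm{echo}_2(0))\wedge(\mathrm{output}(1)\to_w\mathsf{Quorum}\,\mathrm{echo}_2(1))$; CaOutput'?: $\mathrm{output}(0.5)\to_w(\mathsf{Quorum}\,\mathrm{echo}_1(0)\wedge\mathsf{Quorum}\,\mathrm{echo}_1(1))$; CaCorrect: $\mathsf{Quorum}\,\mathrm{correct}(\mathrm{input},\mathrm{echo}_1,\mathrm{echo}_2,\mathrm{output})$;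 CaCorrect': $\mathrm{correct}(R)\vee\mathrm{incorrect}(R)$ for each $R\in\{\mathrm{input},\mathrm{echo}_1,\mathrm{echo}_2,\mathrm{output}\}$; CaInput: $(\mathrm{input}(0)\oplus\mathrm{input}(1))\wedge\neg\mathrm{input}(0.5)$; CaEcho2$_{01}$: $\exists_{01}a.\mathrm{echo}_2(a)$; CaEcho1!: $(\mathrm{input}(a)\vee\mathsf{Contraquorum}\,\mathrm{echo}_1(a))\to_w\mathrm{echo}_1(a)$; CaEcho2!: $(\exists a.\mathsf{Quorum}\,\mathrm{echo}_1(a))\to_w\exists a.\mathrm{echo}_2(a)$; CaOutput!: $\mathsf{Quorum}\,\mathrm{echo}_2(a)\to_w\mathrm{output}(a)$; CaOutput'!: $(\mathsf{Quorum}\,\mathrm{echo}_1(0)\wedge\mathsf{Quorum}\,\mathrm{echo}_1(1))\to_w\mathrm{output}(0.5)$. -}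

module Defs where

open import Level using (Level; _⊔_) renaming (suc to lsuc; zero to lzero)
open import Data.Unit using (⊤)
open import Data.Product using (Σ; _×_; _,_; proj₁; proj₂)
open import Function.Bundles using (_⇔_)

data 𝟛 : Set where
  𝕗 𝕓 𝕥 : 𝟛

data _≤₃_ : 𝟛 → 𝟛 → Set where
  f≤ : ∀ {x} → 𝕗 ≤₃ x
  b≤b : 𝕓 ≤₃ 𝕓
  b≤t : 𝕓 ≤₃ 𝕥
  t≤t : 𝕥 ≤₃ 𝕥

infixr 6 _∧₃_
infixr 5 _∨₃_
infixr 4 _→w_ _→s_

_∧₃_ : 𝟛 → 𝟛 → 𝟛
𝕗 ∧₃ y = 𝕗
𝕓 ∧₃ 𝕗 = 𝕗
𝕓 ∧₃ y = 𝕓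
𝕥 ∧₃ y = y

_∨₃_ : 𝟛 → 𝟛 → 𝟛
𝕗 ∨₃ y = y
𝕓 ∨₃ 𝕥 = 𝕥
𝕓 ∨₃ y = 𝕓
𝕥 ∨₃ y = 𝕥

¬₃ : 𝟛 → 𝟛
¬₃ 𝕥 = 𝕗
¬₃ 𝕓 = 𝕓
¬₃ 𝕗 = 𝕥

T₃ : 𝟛 → 𝟛
T₃ 𝕥 = 𝕥
T₃ _ = 𝕗

B₃ : 𝟛 → 𝟛
B₃ 𝕓 = 𝕥
B₃ _ = 𝕗

TF₃ : 𝟛 → 𝟛
TF₃ 𝕓 = 𝕗
TF₃ _ = 𝕥

_→w_ : 𝟛 → 𝟛 → 𝟛
x →w y = ¬₃ x ∨₃ y

_→s_ : 𝟛 → 𝟛 → 𝟛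
x →s y = ¬₃ x ∨₃ T₃ y

_⊕₃_ : 𝟛 → 𝟛 → 𝟛
𝕓 ⊕₃ y = 𝕓
x ⊕₃ 𝕓 = 𝕓
𝕥 ⊕₃ 𝕥 = 𝕗
𝕥 ⊕₃ 𝕗 = 𝕥
𝕗 ⊕₃ 𝕥 = 𝕥
𝕗 ⊕₃ 𝕗 = 𝕗

data Valid : 𝟛 → Set where
  valid-t : Valid 𝕥
  valid-b : Valid 𝕓

InfIs : ∀ {ℓ} {I : Set ℓ} → (I → 𝟛) → 𝟛 → Set ℓ
InfIs {I = I} g x =
  ((i : I) → x ≤₃ g i) × ((y : 𝟛) → ((i : I) → y ≤₃ g i) → y ≤₃ x)

SupIs : ∀ {ℓ} {I : Set ℓ} → (I → 𝟛) → 𝟛 → Set ℓ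
SupIs {I = I} g x =
  ((i : I) → g i ≤₃ x) × ((y : 𝟛) → ((i : I) → g i ≤₃ y) → x ≤₃ y)

record Semitopology : Set₂ where
  field
    Pt   : Set
    Open : (Pt → Set) → Set₁
    -- openness is a property of the subset (extensional)
    open-ext : ∀ {O O' : Pt → Set} → Open O → (∀ p → O p ⇔ O' p) → Open O'
    open-whole : Open (λ _ → ⊤)
    open-⋃ : ∀ {I : Set} (U : I → Pt → Set) → (∀ i → Open (U i)) →
             Open (λ p → Σ I (λ i → U i p))

module _ (S : Semitopology) where
  open Semitopology S

  NonEmpty : (Pt → Set) → Set
  NonEmpty O = Σ Pt O

  NEOpen : Set₁
  NEOpen = Σ (Pt → Set) (λ O → Open O × NonEmpty O)

  ThreeTwined : Set₁
  ThreeTwined = ∀ (O₁ O₂ O₃ : NEOpen) →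
    Σ Pt (λ p → proj₁ O₁ p × proj₁ O₂ p × proj₁ O₃ p)

  EverywhereIs : (Pt → 𝟛) → 𝟛 → Set
  EverywhereIs f x = InfIs f x

  SomewhereIs : (Pt → 𝟛) → 𝟛 → Set
  SomewhereIs f x = SupIs f x

  -- Quorum f = ⋁_{O ∈ O^{≠∅}} ⋀_{p ∈ O} f(p)
  -- (family of the values ⋀_{p∈O} f(p), O ranging over nonempty opens)
  QuorumIs : (Pt → 𝟛) → 𝟛 → Set₁
  QuorumIs f x =
    SupIs {I = Σ NEOpen (λ O → Σ 𝟛 (λ y →
                 InfIs {I = Σ Pt (proj₁ O)} (λ q → f (proj₁ q)) y))}
          (λ i → proj₁ (proj₂ i)) x

  -- Contraquorum f = ⋀_{O ∈ O^{≠∅}} ⋁_{p ∈ O} f(p)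
  ContraquorumIs : (Pt → 𝟛) → 𝟛 → Set₁
  ContraquorumIs f x =
    InfIs {I = Σ NEOpen (λ O → Σ 𝟛 (λ y →
                 SupIs {I = Σ Pt (proj₁ O)} (λ q → f (proj₁ q)) y))}
          (λ i → proj₁ (proj₂ i)) x

data Val : Set where
  v0 v½ v1 : Val

_≐_ : Val → Val → 𝟛
v0 ≐ v0 = 𝕥
v½ ≐ v½ = 𝕥
v1 ≐ v1 = 𝕥
_  ≐ _  = 𝕗

⋀V : (Val → 𝟛) → 𝟛
⋀V g = g v0 ∧₃ g v½ ∧₃ g v1

⋁V : (Val → 𝟛) → 𝟛
⋁V g = g v0 ∨₃ g v½ ∨₃ g v1

data Sym : Set where
  input echo₁ echo₂ output : Sym

record Model : Set₂ where
  field
    sp : Semitopology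
  open Semitopology sp public
  field
    ς : Sym → Pt → Val → 𝟛

module _ (μ : Model) where
  open Model μ

  correct : Sym → Pt → 𝟛
  correct R p = ⋀V (λ a → TF₃ (ς R p a))

  incorrect : Sym → Pt → 𝟛
  incorrect R p = ⋀V (λ a → B₃ (ς R p a))

  correctAll : Pt → 𝟛
  correctAll p = correct input p ∧₃ correct echo₁ p ∧₃
                 correct echo₂ p ∧₃ correct output p

  Q : (Pt → 𝟛) → 𝟛 → Set₁
  Q = QuorumIs sp

  -- Validity of each axiom of ThyCA in μ. A subformula Quorum φ etc. is
  -- given by its (unique) value, witnessed by the relation QuorumIs etc.
  record ThyCA-valid : Set₁ where
    field
      caEcho1? : ∀ p a → Σ 𝟛 λ s → SomewhereIs sp (λ q → ς input q a) s ×
                   Valid (ς echo₁ p a →s s)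
      caEcho2? : ∀ p a → Σ 𝟛 λ q → Q (λ x → ς echo₁ x a) q ×
                   Valid (ς echo₂ p a →w q)
      caOutput? : ∀ p → Σ 𝟛 λ q0 → Σ 𝟛 λ q1 →
                   Q (λ x → ς echo₂ x v0) q0 × Q (λ x → ς echo₂ x v1) q1 ×
                   Valid ((ς output p v0 →w q0) ∧₃ (ς output p v1 →w q1))
      caOutput'? : ∀ p → Σ 𝟛 λ q0 → Σ 𝟛 λ q1 →
                   Q (λ x → ς echo₁ x v0) q0 × Q (λ x → ς echo₁ x v1) q1 ×
                   Valid (ς output p v½ →w (q0 ∧₃ q1))
      caCorrect : ∀ (p : Pt) → Σ 𝟛 λ q → Q correctAll q × Valid q
      caCorrect' : ∀ R p → Valid (correct R p ∨₃ incorrect R p)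
      caInput : ∀ p → Valid ((ς input p v0 ⊕₃ ς input p v1) ∧₃ ¬₃ (ς input p v½))
      caEcho2₀₁ : ∀ p → Valid (⋀V λ v → ⋀V λ v' →
                   (ς echo₂ p v ∧₃ ς echo₂ p v') →w (v ≐ v'))
      caEcho1! : ∀ p a → Σ 𝟛 λ c → ContraquorumIs sp (λ x → ς echo₁ x a) c ×
                   Valid ((ς input p a ∨₃ c) →w ς echo₁ p a)
      caEcho2! : ∀ p → Σ (Val → 𝟛) λ qs → (∀ a → Q (λ x → ς echo₁ x a) (qs a)) ×
                   Valid (⋁V qs →w ⋁V (ς echo₂ p))
      caOutput! : ∀ p a → Σ 𝟛 λ q → Q (λ x → ς echo₂ x a) q ×
                   Valid (q →w ς output p a)
      caOutput'! : ∀ p → Σ 𝟛 λ q0 → Σ 𝟛 λ q1 →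
                   Q (λ x → ς echo₁ x v0) q0 × Q (λ x → ς echo₁ x v1) q1 ×
                   Valid ((q0 ∧₃ q1) →w ς output p v½)

-- At 0.5 the conclusion reads "φ(0.5) is not true", and this propagates up the
-- protocol: no point inputs 0.5 as true (CaInput), so Somewhere input(0.5) is at most
-- b and CaEcho1? forbids a true echo₁(0.5). A true echo₂(0.5) would by CaEcho2? make
-- Quorum echo₁(0.5) valid; its open set meets the open set of correct points from
-- CaCorrect (twinedness), and at a correct point a valid echo₁(0.5) is true.
module Submission where

open import Defs
open import Data.Product using (_×_; Σ; _,_; proj₁; proj₂)
open import Data.Empty using (⊥)
open import Relation.Nullary using (¬_)
open import Relation.Binary.PropositionalEquality using (_≡_; _≢_; refl)

Valid-mono : ∀ {x y} → x ≤₃ y → Valid x → Valid y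
Valid-mono b≤b v = v
Valid-mono b≤t _ = valid-t
Valid-mono t≤t v = v

Valid-∧ : ∀ x y → Valid (x ∧₃ y) → Valid x × Valid y
Valid-∧ 𝕓 𝕓 v = v , v
Valid-∧ 𝕓 𝕥 v = v , valid-t
Valid-∧ 𝕥 y v = valid-t , v

Valid-¬₃⇒≢𝕥 : ∀ {x} → Valid (¬₃ x) → x ≢ 𝕥
Valid-¬₃⇒≢𝕥 () refl

Valid-𝕥→s⇒≡𝕥 : ∀ {y} → Valid (𝕥 →s y) → y ≡ 𝕥
Valid-𝕥→s⇒≡𝕥 {𝕥} _ = refl

Valid-→s-𝕥 : ∀ x → Valid (x →s 𝕥)
Valid-→s-𝕥 𝕗 = valid-t
Valid-→s-𝕥 𝕓 = valid-t
Valid-→s-𝕥 𝕥 = valid-t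

≢𝕥⇒Valid-→s-𝕗 : ∀ {x} → x ≢ 𝕥 → Valid (x →s 𝕗)
≢𝕥⇒Valid-→s-𝕗 {𝕗} _ = valid-t
≢𝕥⇒Valid-→s-𝕗 {𝕓} _ = valid-b
≢𝕥⇒Valid-→s-𝕗 {𝕥} x≢𝕥 with () ← x≢𝕥 refl

≢𝕥⇒≤₃𝕓 : ∀ {x} → x ≢ 𝕥 → x ≤₃ 𝕓
≢𝕥⇒≤₃𝕓 {𝕗} _ = f≤
≢𝕥⇒≤₃𝕓 {𝕓} _ = b≤b
≢𝕥⇒≤₃𝕓 {𝕥} x≢𝕥 with () ← x≢𝕥 refl

¬Valid⇒≤₃ : ∀ {x} → ¬ Valid x → ∀ {y} → x ≤₃ y
¬Valid⇒≤₃ {𝕗} _ = f≤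
¬Valid⇒≤₃ {𝕓} ¬v with () ← ¬v valid-b
¬Valid⇒≤₃ {𝕥} ¬v with () ← ¬v valid-t

Valid-TF₃⇒≡𝕥 : ∀ {x} → Valid (TF₃ x) → Valid x → x ≡ 𝕥
Valid-TF₃⇒≡𝕥 {𝕥} _ _ = refl

Valid-inf : ∀ {ℓ} {I : Set ℓ} {g : I → 𝟛} {x} → InfIs g x → Valid x → ∀ i → Valid (g i)
Valid-inf (lower , _) vx i = Valid-mono (lower i) vx

-- Only the double negation: the index set of a supremum is arbitrary, so no
-- witness can be extracted constructively.
Valid-sup : ∀ {ℓ} {I : Set ℓ} {g : I → 𝟛} {x} → SupIs g x → Valid x →
            ¬ (∀ i → ¬ Valid (g i))
Valid-sup (_ , least) vx none with () ← Valid-mono (least 𝕗 λ i → ¬Valid⇒≤₃ (none i)) vx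

module _ (S : Semitopology) (twined : ThreeTwined S) where

  Valid-Quorum-meet : ∀ {f g x y} → QuorumIs S f x → QuorumIs S g y → Valid x → Valid y →
                      ¬ (∀ p → Valid (f p) → Valid (g p) → ⊥)
  Valid-Quorum-meet Qf Qg vx vy disjoint =
    Valid-sup Qf vx λ { (O , _ , inf-O) v-O →
      Valid-sup Qg vy λ { (O' , _ , inf-O') v-O' →
        let (r , r∈O , r∈O' , _) = twined O O' O'
        in disjoint r (Valid-inf inf-O v-O (r , r∈O)) (Valid-inf inf-O' v-O' (r , r∈O')) } }

module _ (μ : Model) where
  open Model μ

  correct⇒Valid-TF₃ : ∀ {R p} → Valid (correct μ R p) → ∀ a → Valid (TF₃ (ς R p a))
  correct⇒Valid-TF₃ {R} {p} vc = TF-valid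
    where
    tf : Val → 𝟛
    tf a = TF₃ (ς R p a)

    TF-valid : ∀ a → Valid (tf a)
    TF-valid v0 = proj₁ (Valid-∧ (tf v0) _ vc)
    TF-valid v½ = proj₁ (Valid-∧ (tf v½) (tf v1) (proj₂ (Valid-∧ (tf v0) _ vc)))
    TF-valid v1 = proj₂ (Valid-∧ (tf v½) (tf v1) (proj₂ (Valid-∧ (tf v0) _ vc)))

  correctAll⇒correct-echo₁ : ∀ {p} → Valid (correctAll μ p) → Valid (correct μ echo₁ p)
  correctAll⇒correct-echo₁ {p} vc =
    proj₁ (Valid-∧ (correct μ echo₁ p) (correct μ echo₂ p ∧₃ correct μ output p)
                   (proj₂ (Valid-∧ (correct μ input p) _ vc)))

  module _ (thy : ThyCA-valid μ) where
    open ThyCA-valid thy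

    input-½-≢𝕥 : ∀ p → ς input p v½ ≢ 𝕥
    input-½-≢𝕥 p = Valid-¬₃⇒≢𝕥 (proj₂ (Valid-∧ _ _ (caInput p)))

    Somewhere-input-½-≤₃𝕓 : ∀ {s} → SomewhereIs sp (λ q → ς input q v½) s → s ≤₃ 𝕓
    Somewhere-input-½-≤₃𝕓 (_ , least) = least 𝕓 λ q → ≢𝕥⇒≤₃𝕓 (input-½-≢𝕥 q)

    echo₁-½-≢𝕥 : ∀ p → ς echo₁ p v½ ≢ 𝕥
    echo₁-½-≢𝕥 p e≡𝕥 with caEcho1? p v½
    ... | s , somewhere , valid rewrite e≡𝕥 with refl ← Valid-𝕥→s⇒≡𝕥 valid
      with () ← Somewhere-input-½-≤₃𝕓 somewhere

    echo₂-½-≢𝕥 : ThreeTwined sp → ∀ p → ς echo₂ p v½ ≢ 𝕥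
    echo₂-½-≢𝕥 twined p e≡𝕥 with caEcho2? p v½ | caCorrect p
    ... | q , Q-echo₁ , valid | c , Q-correct , valid-c rewrite e≡𝕥 =
      Valid-Quorum-meet sp twined Q-echo₁ Q-correct valid valid-c λ r v-echo₁ v-correct →
        echo₁-½-≢𝕥 r (Valid-TF₃⇒≡𝕥 (correct⇒Valid-TF₃ (correctAll⇒correct-echo₁ v-correct) v½)
                                   v-echo₁)

lemma5p20 : (μ : Model) → ThreeTwined (Model.sp μ) → ThyCA-valid μ →
    ∀ (v : Val) →
    (∀ p → Valid (Model.ς μ input p v →s ((v ≐ v0) ∨₃ (v ≐ v1)))) ×
    (∀ p → Valid (Model.ς μ echo₁ p v →s ((v ≐ v0) ∨₃ (v ≐ v1)))) ×
    (∀ p → Valid (Model.ς μ echo₂ p v →s ((v ≐ v0) ∨₃ (v ≐ v1))))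
lemma5p20 μ twined thy v0 = (λ _ → Valid-→s-𝕥 _) , (λ _ → Valid-→s-𝕥 _) , (λ _ → Valid-→s-𝕥 _)
lemma5p20 μ twined thy v1 = (λ _ → Valid-→s-𝕥 _) , (λ _ → Valid-→s-𝕥 _) , (λ _ → Valid-→s-𝕥 _)
lemma5p20 μ twined thy v½ =
  (λ p → ≢𝕥⇒Valid-→s-𝕗 (input-½-≢𝕥 μ thy p)) ,
  (λ p → ≢𝕥⇒Valid-→s-𝕗 (echo₁-½-≢𝕥 μ thy p)) ,
  (λ p → ≢𝕥⇒Valid-→s-𝕗 (echo₂-½-≢𝕥 μ thy twined p))
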